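{- For all functions $\kappa,\kappa',\kappa'':\mathbb{N}\to\mathbb{N}$, $(\kappa\circ\kappa')\circ\kappa''=\kappa\circ(\kappa'\circ\kappa'')$.
   Context: Untyped modal transformations are functions $\kappa:\mathbb{N}\to\mathbb{N}$. Truncation: $(\kappa|_n)(m)=\kappa(n+m)$. Truncation offset: $L(\kappa,0)=0$, $L(\kappa,1+n)=\kappa(0)+L(\kappa|_1,n)$. Composition (not ordinary function composition) is defined by $(\kappa\circ\kappa')(0)=L(\kappa',\kappa(0))$ and $(\kappa\circ\kappa')(1+n)=((\kappa|_1)\circ(\kappa'|_{\kappa(0)}))(n)$ (by recursion on the argument). -}

module Defs where

open import Data.Nat using (ℕ; zero; suc; _+_)

MT : Set
MT = ℕ → ℕ

_|ₜ_ : MT → ℕ → MT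
(κ |ₜ n) m = κ (n + m)

L : MT → ℕ → ℕ
L κ zero    = 0
L κ (suc n) = κ 0 + L (κ |ₜ 1) n

_⊚_ : MT → MT → MT
(κ ⊚ κ') zero    = L κ' (κ 0)
(κ ⊚ κ') (suc n) = ((κ |ₜ 1) ⊚ (κ' |ₜ κ 0)) n

infixr 9 _⊚_

{-# OPTIONS --safe #-}
-- The offset L κ is the action of κ on positions: L (κ ⊚ κ') = L κ' ∘ L κ, and it
-- is additive, L κ (a + b) = L κ a + L (κ |ₜ a) b. Additivity makes truncation
-- distribute over composition, (κ ⊚ κ') |ₜ n ≗ (κ |ₜ n) ⊚ (κ' |ₜ L κ n), so both
-- sides of the associativity law unfold to the same recursive call at every step.
module Submission where

open import Defs
open import Data.Nat using (ℕ; zero; suc; _+_)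
open import Data.Nat.Properties using (+-assoc)
open import Function using (_∘_)
open import Relation.Binary.PropositionalEquality
  using (_≡_; _≗_; refl; sym; trans; cong; cong₂; module ≡-Reasoning)

open ≡-Reasoning

L-cong : ∀ {κ μ} → κ ≗ μ → ∀ n → L κ n ≡ L μ n
L-cong κ≗μ zero    = refl
L-cong κ≗μ (suc n) = cong₂ _+_ (κ≗μ 0) (L-cong (κ≗μ ∘ suc) n)

|ₜ-cong : ∀ {κ μ} → κ ≗ μ → ∀ {m n} → m ≡ n → (κ |ₜ m) ≗ (μ |ₜ n)
|ₜ-cong κ≗μ refl k = κ≗μ _

|ₜ-|ₜ : ∀ κ m n → ((κ |ₜ m) |ₜ n) ≗ (κ |ₜ (m + n))
|ₜ-|ₜ κ m n k = cong κ (sym (+-assoc m n k))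

⊚-cong : ∀ {κ μ κ' μ'} → κ ≗ μ → κ' ≗ μ' → (κ ⊚ κ') ≗ (μ ⊚ μ')
⊚-cong {κ} {μ' = μ'} κ≗μ κ'≗μ' zero    = trans (L-cong κ'≗μ' (κ 0)) (cong (L μ') (κ≗μ 0))
⊚-cong              κ≗μ κ'≗μ' (suc n) = ⊚-cong (κ≗μ ∘ suc) (|ₜ-cong κ'≗μ' (κ≗μ 0)) n

L-+ : ∀ κ a b → L κ (a + b) ≡ L κ a + L (κ |ₜ a) b
L-+ κ zero    b = refl
L-+ κ (suc a) b = begin
  κ 0 + L (κ |ₜ 1) (a + b)                            ≡⟨ cong (κ 0 +_) (L-+ (κ |ₜ 1) a b) ⟩
  κ 0 + (L (κ |ₜ 1) a + L ((κ |ₜ 1) |ₜ a) b)          ≡⟨ sym (+-assoc (κ 0) _ _) ⟩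
  κ 0 + L (κ |ₜ 1) a + L ((κ |ₜ 1) |ₜ a) b            ≡⟨ cong (L κ (suc a) +_) (L-cong (|ₜ-|ₜ κ 1 a) b) ⟩
  L κ (suc a) + L (κ |ₜ suc a) b                      ∎

L-⊚ : ∀ κ κ' n → L (κ ⊚ κ') n ≡ L κ' (L κ n)
L-⊚ κ κ' zero    = refl
L-⊚ κ κ' (suc n) = begin
  L κ' (κ 0) + L ((κ |ₜ 1) ⊚ (κ' |ₜ κ 0)) n           ≡⟨ cong (L κ' (κ 0) +_) (L-⊚ (κ |ₜ 1) (κ' |ₜ κ 0) n) ⟩
  L κ' (κ 0) + L (κ' |ₜ κ 0) (L (κ |ₜ 1) n)           ≡⟨ sym (L-+ κ' (κ 0) (L (κ |ₜ 1) n)) ⟩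
  L κ' (L κ (suc n))                                  ∎

|ₜ-⊚ : ∀ κ κ' n → ((κ ⊚ κ') |ₜ n) ≗ ((κ |ₜ n) ⊚ (κ' |ₜ L κ n))
|ₜ-⊚ κ κ' zero    m = refl
|ₜ-⊚ κ κ' (suc n) m = begin
  ((κ ⊚ κ') |ₜ suc n) m                               ≡⟨ |ₜ-⊚ (κ |ₜ 1) (κ' |ₜ κ 0) n m ⟩
  (((κ |ₜ 1) |ₜ n) ⊚ ((κ' |ₜ κ 0) |ₜ L (κ |ₜ 1) n)) m ≡⟨ ⊚-cong (|ₜ-|ₜ κ 1 n) (|ₜ-|ₜ κ' (κ 0) _) m ⟩
  ((κ |ₜ suc n) ⊚ (κ' |ₜ L κ (suc n))) m              ∎

lemma6p11 : (κ κ' κ'' : ℕ → ℕ) → (n : ℕ) → ((κ ⊚ κ') ⊚ κ'') n ≡ (κ ⊚ (κ' ⊚ κ'')) n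
lemma6p11 κ κ' κ'' zero    = sym (L-⊚ κ' κ'' (κ 0))
lemma6p11 κ κ' κ'' (suc n) = begin
  (((κ |ₜ 1) ⊚ (κ' |ₜ κ 0)) ⊚ (κ'' |ₜ L κ' (κ 0))) n
    ≡⟨ lemma6p11 (κ |ₜ 1) (κ' |ₜ κ 0) (κ'' |ₜ L κ' (κ 0)) n ⟩
  ((κ |ₜ 1) ⊚ ((κ' |ₜ κ 0) ⊚ (κ'' |ₜ L κ' (κ 0)))) n
    ≡⟨ ⊚-cong (λ _ → refl) (sym ∘ |ₜ-⊚ κ' κ'' (κ 0)) n ⟩
  ((κ |ₜ 1) ⊚ ((κ' ⊚ κ'') |ₜ κ 0)) n
    ∎
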